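{- Let $n \ge 2$ be an integer, let $S_n$ be the set of permutations of $\{1,\dots,n\}$, and equip $S_n$ with the swap neighborhood $N$. Fix $i,p \in \{1,\dots,n\}$ and define $\varphi_{(i,i),(p,p)} : S_n \to \mathbb{R}$ by $\varphi_{(i,i),(p,p)}(x) = \delta_{x(i)}^{p}$, i.e. $1$ if $x(i)=p$ and $0$ otherwise. Then $(S_n, N, \varphi_{(i,i),(p,p)})$ is an elementary landscape with characteristic constant $k = n$.
   Context: Swap neighborhood: for $x \in S_n$, $N(x)$ is the set of permutations obtained from $x$ by exchanging the values at two distinct positions, i.e. $y \in N(x)$ iff $y = x \circ \tau$ for a transposition $\tau$ of $\{1,\dots,n\}$; thus $|N(x)| = d = n(n-1)/2$ for every $x$. For $g : S_n \to \mathbb{R}$ write $\bar g = \frac{1}{n!}\sum_{x \in S_n} g(x)$ and $\langle g \rangle_{N(x)} = \frac{1}{d}\sum_{y \in N(x)} g(y)$. The landscape $(S_n,N,g)$ is elementary with characteristic constant $k$ if for every $x \in S_n$, $\langle g \rangle_{N(x)} = g(x) + \frac{k}{d}\left(\bar g - g(x)\right)$. $\delta$ denotes the Kronecker delta. -}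

module Defs where

open import Data.Nat as ℕ using (ℕ; zero; suc; _∸_; _!; NonZero)
open import Data.Nat.Properties using (_!≢0)
open import Data.Fin using (Fin)
open import Data.Fin.Properties using (_≟_; _<?_)
open import Data.Fin.Permutation.Components using (transpose)
open import Data.Vec using (Vec; []; _∷_; tabulate; lookup; toList)
open import Data.List using (List; []; _∷_; map; filter; concatMap; foldr; allFin)
open import Data.Product using (_×_; _,_)
open import Data.Integer using (+_)
open import Data.Rational using (ℚ; 0ℚ; 1ℚ; _+_; _-_; _*_; _/_)
open import Relation.Nullary.Decidable using (does)
open import Data.Bool using (if_then_else_)

-- A permutation of {1..n} (0-indexed as Fin n) is represented in one-line
-- notation by the vector (x(0), ..., x(n-1)) of its values, with no repeats.

allVecs : (m n : ℕ) → List (Vec (Fin n) m)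
allVecs zero    n = [] ∷ []
allVecs (suc m) n = concatMap (λ a → map (a ∷_) (allVecs m n)) (allFin n)

Sn : (n : ℕ) → List (Vec (Fin n) n)
Sn n = filter (λ v → unique? (toList v)) (allVecs n n)
  where open import Data.List.Relation.Unary.Unique.DecPropositional (_≟_ {n = n}) using (unique?)

sumℚ : List ℚ → ℚ
sumℚ = foldr _+_ 0ℚ

-- pairs of positions {a, b} with a < b (each transposition exactly once)
posPairs : (n : ℕ) → List (Fin n × Fin n)
posPairs n = concatMap (λ a → map (λ b → (a , b)) (filter (a <?_) (allFin n))) (allFin n)

-- x ∘ τ for the transposition τ = (a b): exchange the values at positions a, b
swapPos : ∀ {n} → Vec (Fin n) n → Fin n → Fin n → Vec (Fin n) n
swapPos x a b = tabulate (λ j → lookup x (transpose a b j))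

N : ∀ {n} → Vec (Fin n) n → List (Vec (Fin n) n)
N {n} x = map (λ { (a , b) → swapPos x a b }) (posPairs n)

mean : (n : ℕ) → (Vec (Fin n) n → ℚ) → ℚ
mean n g = sumℚ (map g (Sn n)) * ((+ 1) / (n !)) where instance _ = n !≢0

-- elementary landscape with characteristic constant k, where
-- d = n(n-1)/2, so 1/d = 2/(n(n-1)) and k/d = 2k/(n(n-1)).
IsElementary : (n : ℕ) .{{_ : NonZero (n ℕ.* (n ∸ 1))}} →
               (Vec (Fin n) n → ℚ) → (k : ℕ) → Set
IsElementary n g k =
  ∀ (x : Vec (Fin n) n) → x ∈ Sn n →
    sumℚ (map g (N x)) * ((+ 2) / (n ℕ.* (n ∸ 1)))
      ≡ g x + ((+ (2 ℕ.* k)) / (n ℕ.* (n ∸ 1))) * (mean n g - g x)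
  where
    open import Data.List.Membership.Propositional using (_∈_)
    open import Relation.Binary.PropositionalEquality using (_≡_)

φ : ∀ {n} → Fin n → Fin n → Vec (Fin n) n → ℚ
φ i p x = if does (lookup x i ≟ p) then 1ℚ else 0ℚ

-- Write n = m + 2 and let x be a permutation.  Its neighbours are x∘(a b), a < b, and
-- (x∘(a b))(i) = x((a b)(i)).  The n-1 transpositions moving i send it to every other
-- position once, the other  triangle (n-1) = (n-1)(n-2)/2  fix it (pairSum-transpose).  As a
-- permutation takes the value p exactly once (occurrences-bijective), the number T of
-- neighbours y with y(i) = p satisfies  T + φ(x) = 1 + triangle (n-1) · φ(x)
-- (neighbours-pinned).  Counting duplicate-free completions of a prefix shows that exactly
-- (n-1)! permutations have x(i) = p (permutations-pinned), so the mean of φ is (n-1)!/n!.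
-- The landscape equation with k = n is then a field identity in ℚ (landscape-arith), proved
-- with the ring solver after embedding ℕ into ℚ.
module Submission where

open import Defs
open import Data.Nat using (ℕ; suc)
open import Data.Fin using (Fin)

module FiniteSums where

  open import Data.Nat using (zero; _+_; _*_; _≤_; z≤n; s≤s)
  import Data.Nat.Properties as ℕP
  open import Data.Fin using (zero; suc)
  open import Data.Fin.Properties using (_≟_)
  open import Data.List using (List; []; _∷_; _++_; map; filter; concatMap; foldr; tabulate)
  open import Data.Bool using (true; false; if_then_else_)
  open import Data.Product using (_×_; _,_; proj₁; proj₂)
  open import Data.Empty using (⊥-elim)
  open import Relation.Nullary using (does)
  open import Relation.Unary using (Decidable)
  open import Relation.Binary.PropositionalEquality
  open import Data.Nat.Tactic.RingSolver using (solve-∀)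
  open import Algebra.Properties.Semiring.Sum ℕP.+-*-semiring public
    using (sum-syntax; sum-cong-≗; ∑-distrib-+; ∑-comm; *-distribʳ-sum)

  listSum : {A : Set} → List A → (A → ℕ) → ℕ
  listSum L f = foldr (λ y s → f y + s) 0 L

  listSum-cong : ∀ {A : Set} (L : List A) {f g : A → ℕ} →
    (∀ y → f y ≡ g y) → listSum L f ≡ listSum L g
  listSum-cong []      f≗g = refl
  listSum-cong (y ∷ L) f≗g = cong₂ _+_ (f≗g y) (listSum-cong L f≗g)

  listSum-zero : ∀ {A : Set} (L : List A) → listSum L (λ _ → 0) ≡ 0
  listSum-zero []      = refl
  listSum-zero (y ∷ L) = listSum-zero L

  listSum-++ : ∀ {A : Set} (L M : List A) f → listSum (L ++ M) f ≡ listSum L f + listSum M f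
  listSum-++ []      M f = refl
  listSum-++ (y ∷ L) M f = trans (cong (f y +_) (listSum-++ L M f)) (sym (ℕP.+-assoc (f y) _ _))

  listSum-map : ∀ {A B : Set} (g : A → B) (L : List A) f →
    listSum (map g L) f ≡ listSum L (λ y → f (g y))
  listSum-map g []      f = refl
  listSum-map g (y ∷ L) f = cong (f (g y) +_) (listSum-map g L f)

  listSum-concatMap : ∀ {A B : Set} (h : A → List B) (L : List A) f →
    listSum (concatMap h L) f ≡ listSum L (λ y → listSum (h y) f)
  listSum-concatMap h []      f = refl
  listSum-concatMap h (y ∷ L) f =
    trans (listSum-++ (h y) (concatMap h L) f) (cong (listSum (h y) f +_) (listSum-concatMap h L f))

  listSum-filter : ∀ {A : Set} {P : A → Set} (P? : Decidable P) (L : List A) f →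
    listSum (filter P? L) f ≡ listSum L (λ y → if does (P? y) then f y else 0)
  listSum-filter P? []      f = refl
  listSum-filter P? (y ∷ L) f with does (P? y)
  ... | true  = cong (f y +_) (listSum-filter P? L f)
  ... | false = listSum-filter P? L f

  listSum-tabulate : ∀ n {A : Set} (g : Fin n → A) f → listSum (tabulate g) f ≡ ∑[ j < n ] f (g j)
  listSum-tabulate zero    g f = refl
  listSum-tabulate (suc n) g f = cong (f (g zero) +_) (listSum-tabulate n (λ j → g (suc j)) f)

  ∑-const : ∀ n c → ∑[ j < n ] c ≡ n * c
  ∑-const zero    c = refl
  ∑-const (suc n) c = cong (c +_) (∑-const n c)

  ∑-zero : ∀ n → ∑[ j < n ] 0 ≡ 0
  ∑-zero n = trans (∑-const n 0) (ℕP.*-zeroʳ n)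

  ∑-pick : ∀ n (i : Fin n) (X : Fin n → ℕ) → ∑[ b < n ] (if does (i ≟ b) then X b else 0) ≡ X i
  ∑-pick (suc n) zero    X = trans (cong (X zero +_) (∑-zero n)) (ℕP.+-identityʳ _)
  ∑-pick (suc n) (suc i) X = ∑-pick n i (λ b → X (suc b))

  ∑-pick′ : ∀ n (i : Fin n) (X : Fin n → ℕ) → ∑[ b < n ] (if does (b ≟ i) then X b else 0) ≡ X i
  ∑-pick′ (suc n) zero    X = trans (cong (X zero +_) (∑-zero n)) (ℕP.+-identityʳ _)
  ∑-pick′ (suc n) (suc i) X = ∑-pick′ n i (λ b → X (suc b))

  -- n terms, all equal to v except the i-th which is u (stated without subtraction).
  ∑-one-different : ∀ n (i : Fin n) u v → ∑[ b < n ] (if does (i ≟ b) then u else v) + v ≡ u + n * v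
  ∑-one-different (suc n) zero u v =
    trans (cong (λ s → u + s + v) (∑-const n v)) (shuffle u (n * v) v)
    where
      shuffle : ∀ u s v → u + s + v ≡ u + (v + s)
      shuffle = solve-∀
  ∑-one-different (suc n) (suc i) u v = begin
      v + ∑[ b < n ] (if does (i ≟ b) then u else v) + v
    ≡⟨ ℕP.+-assoc v _ v ⟩
      v + (∑[ b < n ] (if does (i ≟ b) then u else v) + v)
    ≡⟨ cong (v +_) (∑-one-different n i u v) ⟩
      v + (u + n * v)
    ≡⟨ shuffle v u (n * v) ⟩
      u + (v + n * v) ∎
    where
      open ≡-Reasoning
      shuffle : ∀ v u s → v + (u + s) ≡ u + (v + s)
      shuffle = solve-∀

  ∑-bounded : ∀ n (f : Fin n → ℕ) → (∀ j → f j ≤ 1) → ∑[ j < n ] f j ≤ n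
  ∑-bounded zero    f f≤1 = z≤n
  ∑-bounded (suc n) f f≤1 = ℕP.+-mono-≤ (f≤1 zero) (∑-bounded n (λ j → f (suc j)) (λ j → f≤1 (suc j)))

  head-and-tail : ∀ n (f : Fin (suc n) → ℕ) → (∀ j → f j ≤ 1) → ∑[ j < suc n ] f j ≡ suc n →
    f zero ≡ 1 × ∑[ j < n ] f (suc j) ≡ n
  head-and-tail n f f≤1 ∑≡n = split (f≤1 zero) (∑-bounded n _ (λ j → f≤1 (suc j))) ∑≡n
    where
      split : ∀ {a b} → a ≤ 1 → b ≤ n → a + b ≡ suc n → a ≡ 1 × b ≡ n
      split z≤n       b≤n b≡1+n   = ⊥-elim (ℕP.<-irrefl refl (ℕP.≤-trans (ℕP.≤-reflexive (sym b≡1+n)) b≤n))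
      split (s≤s z≤n) b≤n 1+b≡1+n = refl , ℕP.suc-injective 1+b≡1+n

  ∑-saturated : ∀ n (f : Fin n → ℕ) → (∀ j → f j ≤ 1) → ∑[ j < n ] f j ≡ n → ∀ j → f j ≡ 1
  ∑-saturated (suc n) f f≤1 ∑≡n zero    = proj₁ (head-and-tail n f f≤1 ∑≡n)
  ∑-saturated (suc n) f f≤1 ∑≡n (suc j) =
    ∑-saturated n (λ j → f (suc j)) (λ j → f≤1 (suc j)) (proj₂ (head-and-tail n f f≤1 ∑≡n)) j

module Transpositions where

  open import Data.Nat using (zero; _+_; _*_)
  import Data.Nat.Properties as ℕP
  open import Data.Fin using (zero; suc)
  open import Data.Fin.Properties using (_≟_; _<?_)
  open import Data.Fin.Permutation.Components using (transpose)
  open import Data.Bool using (true; false; if_then_else_)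
  open import Data.List using (map; filter; allFin)
  open import Data.Product using (_×_; _,_)
  open import Relation.Nullary using (does)
  open import Relation.Binary.PropositionalEquality
  open import Data.Nat.Tactic.RingSolver using (solve-∀)
  open FiniteSums

  pairSum : ∀ n → (Fin n → Fin n → ℕ) → ℕ
  pairSum n F = ∑[ a < n ] ∑[ b < n ] (if does (a <? b) then F a b else 0)

  -- triangle k = 0 + 1 + ⋯ + (k-1) = k(k-1)/2, the number of pairs a < b in Fin k.
  triangle : ℕ → ℕ
  triangle zero    = 0
  triangle (suc k) = k + triangle k

  triangle-double : ∀ k → 2 * triangle (suc k) ≡ suc k * k
  triangle-double zero    = refl
  triangle-double (suc k) = begin
      2 * (suc k + triangle (suc k))
    ≡⟨ ℕP.*-distribˡ-+ 2 (suc k) (triangle (suc k)) ⟩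
      2 * suc k + 2 * triangle (suc k)
    ≡⟨ cong (2 * suc k +_) (triangle-double k) ⟩
      2 * suc k + suc k * k
    ≡⟨ factor k ⟩
      suc (suc k) * suc k ∎
    where
      open ≡-Reasoning
      factor : ∀ k → 2 * suc k + suc k * k ≡ suc (suc k) * suc k
      factor = solve-∀

  pairSum-const : ∀ n c → pairSum n (λ _ _ → c) ≡ triangle n * c
  pairSum-const zero    c = refl
  pairSum-const (suc n) c rewrite pairSum-const n c | ∑-const n c = sym (ℕP.*-distribʳ-+ c n (triangle n))

  listSum-posPairs : ∀ n (F : Fin n × Fin n → ℕ) → listSum (posPairs n) F ≡ pairSum n (λ a b → F (a , b))
  listSum-posPairs n F = begin
      listSum (posPairs n) F
    ≡⟨ listSum-concatMap (λ a → map (λ b → (a , b)) (filter (a <?_) (allFin n))) (allFin n) F ⟩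
      listSum (allFin n) (λ a → listSum (map (λ b → (a , b)) (filter (a <?_) (allFin n))) F)
    ≡⟨ listSum-tabulate n (λ a → a) _ ⟩
      ∑[ a < n ] listSum (map (λ b → (a , b)) (filter (a <?_) (allFin n))) F
    ≡⟨ sum-cong-≗ (λ a → begin
          listSum (map (λ b → (a , b)) (filter (a <?_) (allFin n))) F
        ≡⟨ listSum-map (λ b → (a , b)) (filter (a <?_) (allFin n)) F ⟩
          listSum (filter (a <?_) (allFin n)) (λ b → F (a , b))
        ≡⟨ listSum-filter (a <?_) (allFin n) (λ b → F (a , b)) ⟩
          listSum (allFin n) (λ b → if does (a <? b) then F (a , b) else 0)
        ≡⟨ listSum-tabulate n (λ b → b) _ ⟩
          ∑[ b < n ] (if does (a <? b) then F (a , b) else 0) ∎) ⟩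
      pairSum n (λ a b → F (a , b)) ∎
    where open ≡-Reasoning

  transpose-suc : ∀ {n} (a b k : Fin n) → transpose (suc a) (suc b) (suc k) ≡ suc (transpose a b k)
  transpose-suc a b k with does (k ≟ a)
  ... | true  = refl
  ... | false with does (k ≟ b)
  ...   | true  = refl
  ...   | false = refl

  transpose-zero : ∀ {n} (b k : Fin n) (g : Fin (suc n) → ℕ) →
    g (transpose zero (suc b) (suc k)) ≡ (if does (k ≟ b) then g zero else g (suc k))
  transpose-zero b k g with does (k ≟ b)
  ... | true  = refl
  ... | false = refl

  -- Summing g over the images of i under all transpositions of Fin (n+1): the n pairs
  -- containing i move it to each other position once, the triangle n other pairs fix it.
  -- g i is added on the left to avoid subtraction.
  pairSum-transpose : ∀ n (i : Fin (suc n)) (g : Fin (suc n) → ℕ) →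
    pairSum (suc n) (λ a b → g (transpose a b i)) + g i ≡ ∑[ j < suc n ] g j + triangle n * g i
  pairSum-transpose n zero g = begin
      ∑[ b < n ] g (suc b) + pairSum n (λ _ _ → g zero) + g zero
    ≡⟨ cong (λ s → ∑[ b < n ] g (suc b) + s + g zero) (pairSum-const n (g zero)) ⟩
      ∑[ b < n ] g (suc b) + triangle n * g zero + g zero
    ≡⟨ rotate (∑[ b < n ] g (suc b)) (triangle n * g zero) (g zero) ⟩
      g zero + ∑[ b < n ] g (suc b) + triangle n * g zero ∎
    where
      open ≡-Reasoning
      rotate : ∀ s t g₀ → s + t + g₀ ≡ g₀ + s + t
      rotate = solve-∀
  pairSum-transpose (suc n) (suc i) g = ℕP.+-cancelʳ-≡ v _ _ (begin
      X + P + v + v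
    ≡⟨ regroup X P v ⟩
      (X + v) + (P + v)
    ≡⟨ cong₂ _+_ first-row lower-pairs ⟩
      (g zero + suc n * v) + (∑[ j < suc n ] g (suc j) + triangle n * v)
    ≡⟨ collect (g zero) n v (∑[ j < suc n ] g (suc j)) (triangle n) ⟩
      g zero + ∑[ j < suc n ] g (suc j) + triangle (suc n) * v + v ∎)
    where
      open ≡-Reasoning
      v = g (suc i)
      -- pairs (0, b+1) and pairs (a+1, b+1)
      X = ∑[ b < suc n ] g (transpose zero (suc b) (suc i))
      P = pairSum (suc n) (λ a b → g (transpose (suc a) (suc b) (suc i)))
      regroup : ∀ X P v → X + P + v + v ≡ (X + v) + (P + v)
      regroup = solve-∀
      collect : ∀ g₀ n v S t → (g₀ + suc n * v) + (S + t * v) ≡ g₀ + S + (n + t) * v + v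
      collect = solve-∀
      first-row : X + v ≡ g zero + suc n * v
      first-row = trans (cong (_+ v) (sum-cong-≗ (λ b → transpose-zero b i g)))
                        (∑-one-different (suc n) i (g zero) v)
      lower-pairs : P + v ≡ ∑[ j < suc n ] g (suc j) + triangle n * v
      lower-pairs = trans
        (cong (_+ v) (sum-cong-≗ (λ a → sum-cong-≗ (λ b →
          cong (λ k → if does (a <? b) then g k else 0) (transpose-suc a b i)))))
        (pairSum-transpose n i (λ j → g (suc j)))

module Distinct {n : ℕ} where

  open import Data.Nat using (_≤_; z≤n)
  import Data.Nat.Properties as ℕP
  open import Data.Fin.Properties using (_≟_)
  open import Data.Vec using (Vec; []; _∷_; lookup; toList)
  open import Data.List using (List; []; _∷_; _++_; [_])
  open import Data.List.Relation.Unary.All using (All; []; _∷_)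
  import Data.List.Relation.Unary.All.Properties as All
  open import Data.List.Relation.Unary.Any using (here; there)
  open import Data.List.Relation.Unary.Unique.Propositional using (Unique; []; _∷_)
  import Data.List.Relation.Unary.Unique.Propositional.Properties as Unique
  open import Data.List.Membership.Propositional using (_∉_)
  open import Data.Bool using (if_then_else_)
  open import Data.Product using (_,_)
  open import Data.Empty using (⊥-elim)
  open import Relation.Nullary using (yes; no; does)
  open import Relation.Binary.PropositionalEquality hiding ([_])
  open FiniteSums

  δ : Fin n → Fin n → ℕ
  δ a p = if does (a ≟ p) then 1 else 0

  occurrences : ∀ {k} → Vec (Fin n) k → Fin n → ℕ
  occurrences {k} v p = ∑[ j < k ] δ (lookup v j) p

  occurrences-absent : ∀ {k} (v : Vec (Fin n) k) p → All (λ y → p ≢ y) (toList v) → occurrences v p ≡ 0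
  occurrences-absent []      p []          = refl
  occurrences-absent (a ∷ v) p (p≢a ∷ p∉v) with a ≟ p
  ... | yes refl = ⊥-elim (p≢a refl)
  ... | no  _    = occurrences-absent v p p∉v

  occurrences-≤1 : ∀ {k} (v : Vec (Fin n) k) p → Unique (toList v) → occurrences v p ≤ 1
  occurrences-≤1 []      p []          = z≤n
  occurrences-≤1 (a ∷ v) p (a∉v ∷ v!) with a ≟ p
  ... | yes refl = ℕP.≤-reflexive (cong suc (occurrences-absent v a a∉v))
  ... | no  _    = occurrences-≤1 v p v!

  occurrences-total : ∀ {k} (v : Vec (Fin n) k) → ∑[ p < n ] occurrences v p ≡ k
  occurrences-total {k} v = begin
      ∑[ p < n ] ∑[ j < k ] δ (lookup v j) p
    ≡⟨ ∑-comm (λ p j → δ (lookup v j) p) ⟩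
      ∑[ j < k ] ∑[ p < n ] δ (lookup v j) p
    ≡⟨ sum-cong-≗ (λ j → ∑-pick n (lookup v j) (λ _ → 1)) ⟩
      ∑[ j < k ] 1
    ≡⟨ trans (∑-const k 1) (ℕP.*-identityʳ k) ⟩
      k ∎
    where open ≡-Reasoning

  -- Pigeonhole: a vector of n distinct values in Fin n takes every value exactly once.
  occurrences-bijective : (x : Vec (Fin n) n) → Unique (toList x) → ∀ p → occurrences x p ≡ 1
  occurrences-bijective x x! =
    ∑-saturated n (occurrences x) (λ p → occurrences-≤1 x p x!) (occurrences-total x)

  unique-prefix : ∀ S {w : List (Fin n)} → Unique (S ++ w) → Unique S
  unique-prefix []      _         = []
  unique-prefix (s ∷ S) (s∉ ∷ S!) = All.++⁻ˡ S s∉ ∷ unique-prefix S S!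

  unique-snoc : ∀ (S : List (Fin n)) a → Unique S → a ∉ S → Unique (S ++ [ a ])
  unique-snoc S a S! a∉S = Unique.++⁺ S! ([] ∷ []) λ { (a∈S , here refl) → a∉S a∈S }

  unique-snoc⁻ : ∀ (S : List (Fin n)) a → Unique (S ++ [ a ]) → a ∉ S
  unique-snoc⁻ (s ∷ S) a (s∉ ∷ S!) (here refl) with All.++⁻ʳ S s∉
  ... | a≢a ∷ [] = a≢a refl
  unique-snoc⁻ (s ∷ S) a (s∉ ∷ S!) (there a∈S) = unique-snoc⁻ S a S! a∈S

  unique-swap : ∀ (S : List (Fin n)) a b w → Unique (S ++ a ∷ b ∷ w) → Unique (S ++ b ∷ a ∷ w)
  unique-swap []      a b w ((a≢b ∷ a∉w) ∷ (b∉w ∷ w!)) = ((λ b≡a → a≢b (sym b≡a)) ∷ b∉w) ∷ (a∉w ∷ w!)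
  unique-swap (s ∷ S) a b w (s∉ ∷ S!) = all-swap S s∉ ∷ unique-swap S a b w S!
    where
      all-swap : ∀ {P : Fin n → Set} S → All P (S ++ a ∷ b ∷ w) → All P (S ++ b ∷ a ∷ w)
      all-swap []      (pa ∷ pb ∷ pw) = pb ∷ pa ∷ pw
      all-swap (s ∷ S) (ps ∷ pS)      = ps ∷ all-swap S pS

module FallingFactorial where

  open import Data.Nat using (zero; _*_; pred; _!)
  open import Relation.Binary.PropositionalEquality using (_≡_; refl; cong)

  falling : ℕ → ℕ → ℕ
  falling k zero    = 1
  falling k (suc m) = k * falling (pred k) m

  falling-! : ∀ k → falling k k ≡ k !
  falling-! zero    = refl
  falling-! (suc k) = cong (suc k *_) (falling-! k)

-- Counting duplicate-free vectors over Fin n by extending a prefix one value at a time: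
-- a duplicate-free prefix S has  f (f-1) ⋯ (f-m+1)  duplicate-free completions of length m,
-- where f is the number of values not used by S.
module Completions {n : ℕ} where

  open import Data.Nat using (zero; _+_; _*_; pred)
  import Data.Nat.Properties as ℕP
  open import Data.Fin using (zero; suc)
  open import Data.Fin.Properties using (_≟_)
  open import Data.Vec using (Vec; []; _∷_; lookup; toList)
  open import Data.List using (List; []; _∷_; _++_; [_]; map; allFin)
  open import Data.List.Properties using (++-assoc; ++-identityʳ)
  open import Data.List.Relation.Unary.Any using (here)
  open import Data.List.Relation.Unary.Unique.Propositional using (Unique)
  open import Data.List.Relation.Unary.Unique.DecPropositional (_≟_ {n = n}) using (unique?)
  open import Data.List.Membership.DecPropositional (_≟_ {n = n}) using (_∈?_)
  open import Data.List.Membership.Propositional using (_∉_)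
  open import Data.List.Membership.Propositional.Properties using (∈-++⁺ˡ; ∈-++⁺ʳ; ∈-++⁻)
  open import Data.Bool using (Bool; true; false; if_then_else_)
  open import Data.Sum using (inj₁; inj₂)
  open import Data.Empty using (⊥-elim)
  open import Relation.Nullary using (¬_; yes; no; does)
  open import Relation.Nullary.Decidable using (dec-true; dec-false; does-⇔)
  open import Function.Bundles using (mk⇔)
  open import Relation.Binary.PropositionalEquality hiding ([_])
  open FiniteSums
  open FallingFactorial
  open Distinct {n}

  extends : List (Fin n) → ∀ {m} → Vec (Fin n) m → Bool
  extends S v = does (unique? (S ++ toList v))

  extends-∷ : ∀ S a {m} (v : Vec (Fin n) m) → extends S (a ∷ v) ≡ extends (S ++ [ a ]) v
  extends-∷ S a v = cong (λ L → does (unique? L)) (sym (++-assoc S [ a ] (toList v)))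

  completions : ℕ → List (Fin n) → ℕ
  completions m S = listSum (allVecs m n) (λ v → if extends S v then 1 else 0)

  pinnedCompletions : (m : ℕ) → List (Fin n) → Fin m → Fin n → ℕ
  pinnedCompletions m S i p = listSum (allVecs m n) (λ v → if extends S v then δ (lookup v i) p else 0)

  fresh : List (Fin n) → ℕ
  fresh S = ∑[ b < n ] (if does (b ∈? S) then 0 else 1)

  listSum-allVecs : ∀ m (f : Vec (Fin n) (suc m) → ℕ) →
    listSum (allVecs (suc m) n) f ≡ ∑[ a < n ] listSum (allVecs m n) (λ v → f (a ∷ v))
  listSum-allVecs m f = begin
      listSum (allVecs (suc m) n) f
    ≡⟨ listSum-concatMap (λ a → map (a ∷_) (allVecs m n)) (allFin n) f ⟩
      listSum (allFin n) (λ a → listSum (map (a ∷_) (allVecs m n)) f)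
    ≡⟨ listSum-tabulate n (λ a → a) _ ⟩
      ∑[ a < n ] listSum (map (a ∷_) (allVecs m n)) f
    ≡⟨ sum-cong-≗ (λ a → listSum-map (a ∷_) (allVecs m n) f) ⟩
      ∑[ a < n ] listSum (allVecs m n) (λ v → f (a ∷ v)) ∎
    where open ≡-Reasoning

  completions-suc : ∀ m S → completions (suc m) S ≡ ∑[ a < n ] completions m (S ++ [ a ])
  completions-suc m S = trans (listSum-allVecs m _) (sum-cong-≗ λ a →
    listSum-cong (allVecs m n) (λ v → cong (λ e → if e then 1 else 0) (extends-∷ S a v)))

  completions-repeated : ∀ m S → ¬ Unique S → completions m S ≡ 0
  completions-repeated m S S-repeats = trans (listSum-cong (allVecs m n) none) (listSum-zero (allVecs m n))
    where
      none : ∀ v → (if extends S v then 1 else 0) ≡ 0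
      none v = cong (λ e → if e then 1 else 0)
        (dec-false (unique? (S ++ toList v)) (λ Sv! → S-repeats (unique-prefix S Sv!)))

  fresh-[] : fresh [] ≡ n
  fresh-[] = trans (∑-const n 1) (ℕP.*-identityʳ n)

  fresh-snoc : ∀ S a → a ∉ S → fresh S ≡ suc (fresh (S ++ [ a ]))
  fresh-snoc S a a∉S = begin
      ∑[ b < n ] (if does (b ∈? S) then 0 else 1)
    ≡⟨ sum-cong-≗ split ⟩
      ∑[ b < n ] ((if does (b ∈? (S ++ [ a ])) then 0 else 1) + (if does (a ≟ b) then 1 else 0))
    ≡⟨ ∑-distrib-+ (λ b → if does (b ∈? (S ++ [ a ])) then 0 else 1) (λ b → if does (a ≟ b) then 1 else 0) ⟩
      fresh (S ++ [ a ]) + ∑[ b < n ] (if does (a ≟ b) then 1 else 0)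
    ≡⟨ cong (fresh (S ++ [ a ]) +_) (∑-pick n a (λ _ → 1)) ⟩
      fresh (S ++ [ a ]) + 1
    ≡⟨ ℕP.+-comm _ 1 ⟩
      suc (fresh (S ++ [ a ])) ∎
    where
      open ≡-Reasoning
      split : ∀ b → (if does (b ∈? S) then 0 else 1)
                  ≡ (if does (b ∈? (S ++ [ a ])) then 0 else 1) + (if does (a ≟ b) then 1 else 0)
      split b with b ∈? S | b ∈? (S ++ [ a ]) | a ≟ b
      ... | yes b∈S | _        | yes refl = ⊥-elim (a∉S b∈S)
      ... | yes _   | yes _    | no  _    = refl
      ... | yes b∈S | no  b∉Sa | _        = ⊥-elim (b∉Sa (∈-++⁺ˡ b∈S))
      ... | no  _   | yes _    | yes refl = refl
      ... | no  b∉S | yes b∈Sa | no  a≢b with ∈-++⁻ S b∈Sa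
      ...   | inj₁ b∈S        = ⊥-elim (b∉S b∈S)
      ...   | inj₂ (here b≡a) = ⊥-elim (a≢b (sym b≡a))
      split b | no _ | no b∉Sa | yes refl = ⊥-elim (b∉Sa (∈-++⁺ʳ S (here refl)))
      split b | no _ | no _    | no _     = refl

  completions-count : ∀ m S → Unique S → completions m S ≡ falling (fresh S) m
  completions-count zero S S! = cong (λ e → (if e then 1 else 0) + 0)
    (dec-true (unique? (S ++ [])) (subst Unique (sym (++-identityʳ S)) S!))
  completions-count (suc m) S S! = begin
      completions (suc m) S
    ≡⟨ completions-suc m S ⟩
      ∑[ a < n ] completions m (S ++ [ a ])
    ≡⟨ sum-cong-≗ next ⟩
      ∑[ a < n ] ((if does (a ∈? S) then 0 else 1) * falling (pred (fresh S)) m)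
    ≡⟨ sym (*-distribʳ-sum (falling (pred (fresh S)) m) (λ a → if does (a ∈? S) then 0 else 1)) ⟩
      fresh S * falling (pred (fresh S)) m ∎
    where
      open ≡-Reasoning
      next : ∀ a → completions m (S ++ [ a ]) ≡ (if does (a ∈? S) then 0 else 1) * falling (pred (fresh S)) m
      next a with a ∈? S
      ... | yes a∈S = completions-repeated m (S ++ [ a ]) (λ Sa! → unique-snoc⁻ S a Sa! a∈S)
      ... | no  a∉S = begin
          completions m (S ++ [ a ])
        ≡⟨ completions-count m (S ++ [ a ]) (unique-snoc S a S! a∉S) ⟩
          falling (fresh (S ++ [ a ])) m
        ≡⟨ cong (λ f → falling (pred f) m) (sym (fresh-snoc S a a∉S)) ⟩
          falling (pred (fresh S)) m
        ≡⟨ sym (ℕP.+-identityʳ _) ⟩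
          1 * falling (pred (fresh S)) m ∎

  pinnedCompletions-suc : ∀ m S (i : Fin (suc m)) p → pinnedCompletions (suc m) S i p ≡
    ∑[ a < n ] listSum (allVecs m n) (λ v → if extends (S ++ [ a ]) v then δ (lookup (a ∷ v) i) p else 0)
  pinnedCompletions-suc m S i p = trans (listSum-allVecs m _) (sum-cong-≗ λ a →
    listSum-cong (allVecs m n) (λ v → cong (λ e → if e then δ (lookup (a ∷ v) i) p else 0) (extends-∷ S a v)))

  completions-swap : ∀ m S a b → completions m ((S ++ [ a ]) ++ [ b ]) ≡ completions m ((S ++ [ b ]) ++ [ a ])
  completions-swap m S a b = listSum-cong (allVecs m n) (λ v → cong (λ e → if e then 1 else 0) (same (toList v)))
    where
      same : ∀ w → does (unique? (((S ++ [ a ]) ++ [ b ]) ++ w)) ≡ does (unique? (((S ++ [ b ]) ++ [ a ]) ++ w))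
      same w rewrite ++-assoc (S ++ [ a ]) [ b ] w | ++-assoc S [ a ] (b ∷ w)
                   | ++-assoc (S ++ [ b ]) [ a ] w | ++-assoc S [ b ] (a ∷ w) =
        does-⇔ (mk⇔ (unique-swap S a b w) (unique-swap S b a w)) (unique? _) (unique? _)

  pinnedCompletions-count : ∀ m S (i : Fin (suc m)) p → pinnedCompletions (suc m) S i p ≡ completions m (S ++ [ p ])
  pinnedCompletions-count m S zero p = begin
      pinnedCompletions (suc m) S zero p
    ≡⟨ pinnedCompletions-suc m S zero p ⟩
      ∑[ a < n ] listSum (allVecs m n) (λ v → if extends (S ++ [ a ]) v then δ a p else 0)
    ≡⟨ sum-cong-≗ only-p ⟩
      ∑[ a < n ] (if does (a ≟ p) then completions m (S ++ [ a ]) else 0)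
    ≡⟨ ∑-pick′ n p (λ a → completions m (S ++ [ a ])) ⟩
      completions m (S ++ [ p ]) ∎
    where
      open ≡-Reasoning
      only-p : ∀ a → listSum (allVecs m n) (λ v → if extends (S ++ [ a ]) v then δ a p else 0)
                   ≡ (if does (a ≟ p) then completions m (S ++ [ a ]) else 0)
      only-p a with does (a ≟ p)
      ... | true  = refl
      ... | false = trans (listSum-cong (allVecs m n) (λ v → if-zero (extends (S ++ [ a ]) v)))
                          (listSum-zero (allVecs m n))
        where
          if-zero : ∀ (e : Bool) → (if e then 0 else 0) ≡ 0
          if-zero true  = refl
          if-zero false = refl
  pinnedCompletions-count (suc m) S (suc i) p = begin
      pinnedCompletions (suc (suc m)) S (suc i) p
    ≡⟨ pinnedCompletions-suc (suc m) S (suc i) p ⟩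
      ∑[ a < n ] pinnedCompletions (suc m) (S ++ [ a ]) i p
    ≡⟨ sum-cong-≗ (λ a → pinnedCompletions-count m (S ++ [ a ]) i p) ⟩
      ∑[ a < n ] completions m ((S ++ [ a ]) ++ [ p ])
    ≡⟨ sum-cong-≗ (λ a → completions-swap m S a p) ⟩
      ∑[ a < n ] completions m ((S ++ [ p ]) ++ [ a ])
    ≡⟨ sym (completions-suc m (S ++ [ p ])) ⟩
      completions (suc m) (S ++ [ p ]) ∎
    where open ≡-Reasoning

module RationalArithmetic where

  open import Data.Nat as ℕ using (zero; NonZero; _!)
  import Data.Nat.Properties as ℕP
  open ℕP using (_!≢0)
  open import Data.Integer as ℤ using (+_)
  import Data.Integer.Properties as ℤP
  open import Data.Rational using (ℚ; 0ℚ; 1ℚ; _+_; _*_; _-_; _/_; toℚᵘ)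
  open import Data.Rational.Properties
    using (+-*-ring; toℚᵘ-injective; toℚᵘ-homo-+; toℚᵘ-homo-*; toℚᵘ-fromℚᵘ)
  open import Data.Rational.Unnormalised as ℚᵘ using (mkℚᵘ; *≡*) renaming (_≃_ to _≃ᵘ_)
  import Data.Rational.Unnormalised.Properties as ℚᵘP
  open import Algebra.Bundles using (Ring)
  open import Algebra.Properties.Semiring.Mult (Ring.semiring +-*-ring) using (_×_; ×-homo-+; ×1-homo-*)
  open import Data.List using (List; []; _∷_; map)
  open import Data.Bool using (Bool; true; false; if_then_else_)
  open import Relation.Binary.PropositionalEquality
  open import Data.Rational.Solver using (module +-*-Solver)
  open FiniteSums using (listSum)
  open Transpositions using (triangle; triangle-double)

  ι : ℕ → ℚ
  ι a = a × 1ℚ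

  ι-+ : ∀ a b → ι (a ℕ.+ b) ≡ ι a + ι b
  ι-+ a b = ×-homo-+ 1ℚ a b

  ι-* : ∀ a b → ι (a ℕ.* b) ≡ ι a * ι b
  ι-* = ×1-homo-*

  ι-indicator : ∀ (e : Bool) → ι (if e then 1 else 0) ≡ (if e then 1ℚ else 0ℚ)
  ι-indicator true  = refl
  ι-indicator false = refl

  sumℚ-ι : ∀ {A : Set} (L : List A) (f : A → ℕ) → sumℚ (map (λ y → ι (f y)) L) ≡ ι (listSum L f)
  sumℚ-ι []      f = refl
  sumℚ-ι (y ∷ L) f = trans (cong (λ s → ι (f y) + s) (sumℚ-ι L f)) (sym (ι-+ (f y) (listSum L f)))

  toℚᵘ-ι : ∀ a → toℚᵘ (ι a) ≃ᵘ mkℚᵘ (+ a) 0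
  toℚᵘ-ι zero    = ℚᵘP.≃-refl
  toℚᵘ-ι (suc a) = begin
      toℚᵘ (1ℚ + ι a)
    ≈⟨ toℚᵘ-homo-+ 1ℚ (ι a) ⟩
      toℚᵘ 1ℚ ℚᵘ.+ toℚᵘ (ι a)
    ≈⟨ ℚᵘP.+-congʳ (toℚᵘ 1ℚ) (toℚᵘ-ι a) ⟩
      mkℚᵘ (+ 1) 0 ℚᵘ.+ mkℚᵘ (+ a) 0
    ≈⟨ *≡* (cong (ℤ._* + 1) (cong (λ z → + 1 ℤ.+ z) (ℤP.*-identityʳ (+ a)))) ⟩
      mkℚᵘ (+ suc a) 0 ∎
    where open ℚᵘP.≃-Reasoning

  /-ι : ∀ a d .{{_ : NonZero d}} → (+ a) / d ≡ ι a * ((+ 1) / d)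
  /-ι a (suc k) = toℚᵘ-injective (begin
      toℚᵘ ((+ a) / suc k)
    ≈⟨ toℚᵘ-fromℚᵘ (mkℚᵘ (+ a) k) ⟩
      mkℚᵘ (+ a) k
    ≈⟨ *≡* (cong₂ ℤ._*_ (sym (ℤP.*-identityʳ (+ a))) (cong (λ j → + suc j) (ℕP.+-identityʳ k))) ⟩
      mkℚᵘ (+ a) 0 ℚᵘ.* mkℚᵘ (+ 1) k
    ≈⟨ ℚᵘP.*-cong (toℚᵘ-ι a) (toℚᵘ-fromℚᵘ (mkℚᵘ (+ 1) k)) ⟨
      toℚᵘ (ι a) ℚᵘ.* toℚᵘ ((+ 1) / suc k)
    ≈⟨ toℚᵘ-homo-* (ι a) ((+ 1) / suc k) ⟨
      toℚᵘ (ι a * ((+ 1) / suc k)) ∎)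
    where open ℚᵘP.≃-Reasoning

  ι-recip : ∀ d .{{_ : NonZero d}} → ι d * ((+ 1) / d) ≡ 1ℚ
  ι-recip (suc k) = toℚᵘ-injective (begin
      toℚᵘ (ι (suc k) * ((+ 1) / suc k))
    ≈⟨ toℚᵘ-homo-* (ι (suc k)) ((+ 1) / suc k) ⟩
      toℚᵘ (ι (suc k)) ℚᵘ.* toℚᵘ ((+ 1) / suc k)
    ≈⟨ ℚᵘP.*-cong (toℚᵘ-ι (suc k)) (toℚᵘ-fromℚᵘ (mkℚᵘ (+ 1) k)) ⟩
      mkℚᵘ (+ suc k) 0 ℚᵘ.* mkℚᵘ (+ 1) k
    ≈⟨ *≡* (trans (ℤP.*-identityʳ _) (trans (ℤP.*-identityʳ (+ suc k))
             (trans (cong (λ j → + suc j) (sym (ℕP.+-identityʳ k))) (sym (ℤP.*-identityˡ _))))) ⟩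
      toℚᵘ 1ℚ ∎)
    where open ℚᵘP.≃-Reasoning

  -- The field identity behind the theorem.  With N = M + 2, W = 1/(N(N-1)),
  -- V = 1/(N C), 2L = (N-1)(N-2) and T + b = 1 + L b  one has
  --   T · 2W = b + 2NW · (C V - b).
  landscape-identity : ∀ (M W C V T L b : ℚ) →
    ((1ℚ + (1ℚ + M)) * (1ℚ + M)) * W ≡ 1ℚ →
    ((1ℚ + (1ℚ + M)) * C) * V ≡ 1ℚ →
    ι 2 * L ≡ (1ℚ + M) * M →
    T + b ≡ 1ℚ + L * b →
    T * (ι 2 * W) ≡ b + (ι 2 * (1ℚ + (1ℚ + M)) * W) * (C * V - b)
  landscape-identity M W C V T L b NN₁W≡1 NCV≡1 2L≡N₁M T+b≡1+Lb = begin
      T * (ι 2 * W)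
    ≡⟨ solve 3 (λ T b W → T :* (two :* W) := (T :+ b) :* (two :* W) :- two :* W :* b) refl T b W ⟩
      (T + b) * (ι 2 * W) - ι 2 * W * b
    ≡⟨ cong (λ t → t * (ι 2 * W) - ι 2 * W * b) T+b≡1+Lb ⟩
      (1ℚ + L * b) * (ι 2 * W) - ι 2 * W * b
    ≡⟨ solve 3 (λ L b W → (one :+ L :* b) :* (two :* W) :- two :* W :* b
                       := two :* W :+ (two :* L) :* (W :* b) :- two :* W :* b) refl L b W ⟩
      ι 2 * W + (ι 2 * L) * (W * b) - ι 2 * W * b
    ≡⟨ cong (λ l → ι 2 * W + l * (W * b) - ι 2 * W * b) 2L≡N₁M ⟩
      ι 2 * W + ((1ℚ + M) * M) * (W * b) - ι 2 * W * b
    ≡⟨ solve 3 (λ M W b → two :* W :+ ((one :+ M) :* M) :* (W :* b) :- two :* W :* b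
                       := two :* W :* one :+ (((one :+ (one :+ M)) :* (one :+ M)) :* W) :* b
                            :- two :* (one :+ (one :+ M)) :* W :* b) refl M W b ⟩
      ι 2 * W * 1ℚ + (((1ℚ + (1ℚ + M)) * (1ℚ + M)) * W) * b - ι 2 * (1ℚ + (1ℚ + M)) * W * b
    ≡⟨ cong₂ (λ x y → ι 2 * W * x + y * b - ι 2 * (1ℚ + (1ℚ + M)) * W * b) (sym NCV≡1) NN₁W≡1 ⟩
      ι 2 * W * (((1ℚ + (1ℚ + M)) * C) * V) + 1ℚ * b - ι 2 * (1ℚ + (1ℚ + M)) * W * b
    ≡⟨ solve 5 (λ M W C V b → two :* W :* (((one :+ (one :+ M)) :* C) :* V) :+ one :* b
                                :- two :* (one :+ (one :+ M)) :* W :* b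
                             := b :+ (two :* (one :+ (one :+ M)) :* W) :* (C :* V :- b)) refl M W C V b ⟩
      b + (ι 2 * (1ℚ + (1ℚ + M)) * W) * (C * V - b) ∎
    where
      open ≡-Reasoning
      open +-*-Solver
      one two : ∀ {k} → Polynomial k
      one = con 1ℚ
      two = con (ι 2)

  landscape-arith : ∀ m (T : ℕ) (b : ℚ) →
    ι T + b ≡ 1ℚ + ι (triangle (suc m)) * b →
    ι T * ((+ 2) / (suc (suc m) ℕ.* suc m))
      ≡ b + ((+ (2 ℕ.* suc (suc m))) / (suc (suc m) ℕ.* suc m))
              * (ι (suc m !) * _/_ (+ 1) (suc (suc m) !) {{suc (suc m) !≢0}} - b)
  landscape-arith m T b T+b≡1+Lb = begin
      ι T * ((+ 2) / D)
    ≡⟨ cong (ι T *_) (/-ι 2 D) ⟩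
      ι T * (ι 2 * W)
    ≡⟨ landscape-identity (ι m) W (ι (suc m !)) V (ι T) (ι L) b NN₁W≡1 NCV≡1 2L≡N₁M T+b≡1+Lb ⟩
      b + (ι 2 * ι n * W) * (ι (suc m !) * V - b)
    ≡⟨ cong (λ c → b + c * (ι (suc m !) * V - b)) (trans (cong (_* W) (sym (ι-* 2 n))) (sym (/-ι (2 ℕ.* n) D))) ⟩
      b + ((+ (2 ℕ.* n)) / D) * (ι (suc m !) * V - b) ∎
    where
      open ≡-Reasoning
      n = suc (suc m)
      D = n ℕ.* suc m
      L = triangle (suc m)
      W = (+ 1) / D
      V = _/_ (+ 1) (n !) {{n !≢0}}
      NN₁W≡1 : (ι n * ι (suc m)) * W ≡ 1ℚ
      NN₁W≡1 = trans (cong (_* W) (sym (ι-* n (suc m)))) (ι-recip D)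
      NCV≡1 : (ι n * ι (suc m !)) * V ≡ 1ℚ
      NCV≡1 = trans (cong (_* V) (sym (ι-* n (suc m !)))) (ι-recip (n !) {{n !≢0}})
      2L≡N₁M : ι 2 * ι L ≡ ι (suc m) * ι m
      2L≡N₁M = trans (sym (ι-* 2 L)) (trans (cong ι (triangle-double m)) (ι-* (suc m) m))

module SwapLandscape where

  open import Data.Nat as ℕ using (_+_; _*_; _!)
  open import Data.Fin.Properties using (_≟_)
  open import Data.Fin.Permutation.Components using (transpose)
  open import Data.Vec using (Vec; lookup; toList)
  open import Data.Vec.Properties using (lookup∘tabulate)
  open import Data.List using ([]; [_])
  open import Data.List.Relation.Unary.Unique.Propositional using (Unique)
  open import Data.Bool using (if_then_else_)
  open import Relation.Nullary using (does)
  open import Relation.Binary.PropositionalEquality hiding ([_])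
  open FiniteSums
  open Transpositions
  open Distinct using (δ; occurrences-bijective)
  open FallingFactorial
  open Completions

  permutations-pinned : ∀ m (i p : Fin (suc m)) → listSum (Sn (suc m)) (λ x → δ (lookup x i) p) ≡ m !
  permutations-pinned m i p = begin
      listSum (Sn (suc m)) (λ x → δ (lookup x i) p)
    ≡⟨ listSum-filter (λ v → unique? (toList v)) (allVecs (suc m) (suc m)) _ ⟩
      pinnedCompletions (suc m) [] i p
    ≡⟨ pinnedCompletions-count m [] i p ⟩
      completions m [ p ]
    ≡⟨ completions-count m [ p ] (All.[] ∷ []) ⟩
      falling (fresh [ p ]) m
    ≡⟨ cong (λ f → falling f m) (suc-injective (trans (sym (fresh-snoc [] p (λ ()))) fresh-[])) ⟩
      falling m m
    ≡⟨ falling-! m ⟩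
      m ! ∎
    where
      open ≡-Reasoning
      open import Data.Nat.Properties using (suc-injective)
      import Data.List.Relation.Unary.All as All
      open import Data.List.Relation.Unary.Unique.DecPropositional (_≟_ {n = suc m}) using (unique?; []; _∷_)

  neighbours-pinned : ∀ m (i p : Fin (suc (suc m))) (x : Vec (Fin (suc (suc m))) (suc (suc m))) →
    Unique (toList x) →
    listSum (N x) (λ y → δ (lookup y i) p) + δ (lookup x i) p ≡ 1 + triangle (suc m) * δ (lookup x i) p
  neighbours-pinned m i p x x! = begin
      listSum (N x) (λ y → δ (lookup y i) p) + g i
    ≡⟨ cong (_+ g i) swaps ⟩
      pairSum (suc (suc m)) (λ a b → g (transpose a b i)) + g i
    ≡⟨ pairSum-transpose (suc m) i g ⟩
      ∑[ j < suc (suc m) ] g j + triangle (suc m) * g i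
    ≡⟨ cong (_+ triangle (suc m) * g i) (occurrences-bijective x x! p) ⟩
      1 + triangle (suc m) * g i ∎
    where
      open ≡-Reasoning
      g : Fin (suc (suc m)) → ℕ
      g j = δ (lookup x j) p
      swaps : listSum (N x) (λ y → δ (lookup y i) p) ≡ pairSum (suc (suc m)) (λ a b → g (transpose a b i))
      swaps = trans (listSum-map _ (posPairs (suc (suc m))) _)
        (trans (listSum-posPairs (suc (suc m)) _) (sum-cong-≗ λ a → sum-cong-≗ λ b →
          cong (λ k → if does (a <? b) then δ k p else 0) (lookup∘tabulate (λ j → lookup x (transpose a b j)) i)))
        where open import Data.Fin.Properties using (_<?_)

open import Data.Nat as ℕ using (_!)
open import Data.Nat.Properties using (_!≢0)
open import Data.Vec using (Vec; lookup; toList)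
open import Data.List using (List; map)
open import Data.List.Properties using (map-cong)
open import Data.List.Membership.Propositional using (_∈_)
open import Data.List.Membership.Propositional.Properties using (∈-filter⁻)
open import Data.List.Relation.Unary.Unique.Propositional using (Unique)
open import Data.Fin.Properties using (_≟_)
open import Data.Integer using (+_)
open import Data.Rational using (1ℚ; _+_; _*_; _-_; _/_)
open import Data.Product using (proj₂)
open import Relation.Nullary using (does)
open import Relation.Binary.PropositionalEquality
open FiniteSums using (listSum)
open Transpositions using (triangle)
open Distinct using (δ)
open RationalArithmetic
open SwapLandscape

Sn-unique : ∀ {n} {x : Vec (Fin n) n} → x ∈ Sn n → Unique (toList x)
Sn-unique {n} x∈Sn = proj₂ (∈-filter⁻ (λ v → unique? (toList v)) {xs = allVecs n n} x∈Sn)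
  where open import Data.List.Relation.Unary.Unique.DecPropositional (_≟_ {n = n}) using (unique?)

φ-sum : ∀ {n} (i p : Fin n) (L : List (Vec (Fin n) n)) →
  sumℚ (map (φ i p) L) ≡ ι (listSum L (λ y → δ (lookup y i) p))
φ-sum i p L = trans (cong sumℚ (map-cong (λ y → sym (ι-indicator (does (lookup y i ≟ p)))) L))
                    (sumℚ-ι L (λ y → δ (lookup y i) p))

neighbours-φ : ∀ m (i p : Fin (suc (suc m))) (x : Vec (Fin (suc (suc m))) (suc (suc m))) →
  Unique (toList x) →
  ι (listSum (N x) (λ y → δ (lookup y i) p)) + φ i p x ≡ 1ℚ + ι (triangle (suc m)) * φ i p x
neighbours-φ m i p x x! = begin
    ι T + φ i p x
  ≡⟨ cong (λ s → ι T + s) (sym (ι-indicator (does (lookup x i ≟ p)))) ⟩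
    ι T + ι d
  ≡⟨ sym (ι-+ T d) ⟩
    ι (T ℕ.+ d)
  ≡⟨ cong ι (neighbours-pinned m i p x x!) ⟩
    ι (1 ℕ.+ L ℕ.* d)
  ≡⟨ trans (ι-+ 1 (L ℕ.* d)) (cong (λ s → 1ℚ + s) (ι-* L d)) ⟩
    1ℚ + ι L * ι d
  ≡⟨ cong (λ b → 1ℚ + ι L * b) (ι-indicator (does (lookup x i ≟ p))) ⟩
    1ℚ + ι L * φ i p x ∎
  where
    open ≡-Reasoning
    T = listSum (N x) (λ y → δ (lookup y i) p)
    d = δ (lookup x i) p
    L = triangle (suc m)

lemma1 : (m : ℕ) → (i p : Fin (suc (suc m))) →
    IsElementary (suc (suc m)) (φ i p) (suc (suc m))
lemma1 m i p x x∈Sn = begin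
    sumℚ (map (φ i p) (N x)) * ((+ 2) / D)
  ≡⟨ cong (_* ((+ 2) / D)) (φ-sum i p (N x)) ⟩
    ι T * ((+ 2) / D)
  ≡⟨ landscape-arith m T (φ i p x) (neighbours-φ m i p x (Sn-unique x∈Sn)) ⟩
    φ i p x + ((+ (2 ℕ.* n)) / D) * (ι (suc m !) * V - φ i p x)
  ≡⟨ cong (λ μ → φ i p x + ((+ (2 ℕ.* n)) / D) * (μ * V - φ i p x)) (sym mean-numerator) ⟩
    φ i p x + ((+ (2 ℕ.* n)) / D) * (mean n (φ i p) - φ i p x) ∎
  where
    open ≡-Reasoning
    n = suc (suc m)
    D = n ℕ.* suc m
    V = _/_ (+ 1) (n !) {{n !≢0}}
    T = listSum (N x) (λ y → δ (lookup y i) p)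
    mean-numerator : sumℚ (map (φ i p) (Sn n)) ≡ ι (suc m !)
    mean-numerator = trans (φ-sum i p (Sn n)) (cong ι (permutations-pinned (suc m) i p))
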